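{- Let $c\ge1$ and $k_1,\ldots,k_c\ge 2$. Let $R_{\mathrm{cl}}(k_1,\ldots,k_c)$ be the classical multicolor Ramsey number: the least $N$ such that every coloring of the edges of the complete graph $K_N$ with colors $1,\ldots,c$ contains, for some $i$, a complete subgraph on $k_i$ vertices all of whose edges have color $i$. Let $G_n$ be the coprime graph on vertex set $\{1,\ldots,n\}$, where distinct $a,b$ are adjacent iff $\gcd(a,b)=1$, and let $R^{\mathrm{edge}}_{\mathrm{cop}}(k_1,\ldots,k_c)$ be the least $n$ such that every coloring of the edges of $G_n$ with colors $1,\ldots,c$ contains, for some $i$, a set of $k_i$ vertices forming a clique of $G_n$ all of whose edges have color $i$. Then \[ R^{\mathrm{edge}}_{\mathrm{cop}}(k_1,\ldots,k_c)=p_{R_{\mathrm{cl}}(k_1,\ldots,k_c)-1}, \] where $p_m$ is the $m$-th prime ($p_1=2$). -}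

module Defs where

open import Data.Nat using (ℕ; suc; _≤_; _∸_)
open import Data.Nat.Primality using (Prime; prime?)
open import Data.Nat.Coprimality using (Coprime)
open import Data.Fin using (Fin; toℕ)
open import Data.List using (length; filter; upTo)
open import Data.Product using (Σ; _×_; ∃)
open import Relation.Binary.PropositionalEquality using (_≡_; _≢_)
open import Function.Definitions using (Injective)

-- An edge colouring of a graph on vertex set Fin N with colours Fin c:
-- a symmetric function on pairs of vertices (values on non-edges and on
-- the diagonal are irrelevant; they are never inspected).
record Colouring (N c : ℕ) : Set where
  field
    col : Fin N → Fin N → Fin c
    sym : ∀ x y → col x y ≡ col y x
open Colouring public

record KSubset (N k : ℕ) : Set where
  field
    vtx : Fin k → Fin N
    inj : Injective _≡_ _≡_ vtx
open KSubset public

Mono : ∀ {N c k} → Colouring N c → Fin c → KSubset N k → Set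
Mono χ i S = ∀ a b → a ≢ b → col χ (vtx S a) (vtx S b) ≡ i

ClassicalArrows : ∀ {c} → (Fin c → ℕ) → ℕ → Set
ClassicalArrows {c} ks N =
  (χ : Colouring N c) → ∃ λ i → Σ (KSubset N (ks i)) λ S → Mono χ i S

-- Coprime graph G_n: vertex x : Fin n stands for the integer toℕ x + 1,
-- so the vertex set is {1,…,n}; distinct a,b adjacent iff gcd(a,b)=1.
label : ∀ {n} → Fin n → ℕ
label x = suc (toℕ x)

IsCoprimeClique : ∀ {n k} → KSubset n k → Set
IsCoprimeClique S = ∀ a b → a ≢ b → Coprime (label (vtx S a)) (label (vtx S b))

CoprimeArrows : ∀ {c} → (Fin c → ℕ) → ℕ → Set
CoprimeArrows {c} ks n =
  (χ : Colouring n c) → ∃ λ i → Σ (KSubset n (ks i)) λ S →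
    IsCoprimeClique S × Mono χ i S

IsLeast : (ℕ → Set) → ℕ → Set
IsLeast P N = P N × (∀ m → P m → N ≤ m)

primeCount : ℕ → ℕ
primeCount x = length (filter prime? (upTo (suc x)))

IsNthPrime : ℕ → ℕ → Set
IsNthPrime m p = Prime p × primeCount p ≡ m

-- The coprime graph G_n has clique number and chromatic number both equal
-- to 1 + π(n): the vertex 1 together with the primes ≤ n form a clique, and
-- sending each vertex m to 1 (if m = 1) or to one of its prime factors is a
-- proper colouring with 1 + π(n) colours. Pulling colourings back along the
-- clique and along the proper colouring shows that G_n arrows (k_i) exactly
-- when K_{1+π(n)} does, i.e. when 1 + π(n) ≥ R. As π increases by one
-- precisely at the primes, the least such n is the (R − 1)-th prime.
module Submission where

open import Defs
open import Data.Nat using (ℕ; _≤_; _∸_)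
open import Data.Fin using (Fin)
open import Data.Product using (Σ; _×_)

open import Data.Nat.Base
  using (zero; suc; _+_; _<_; _!; s≤s; z≤n; s≤s⁻¹; _≤′_; ≤′-reflexive; ≤′-step
        ; NonZero; NonTrivial; n>1⇒nonTrivial; nonTrivial⇒nonZero; nonTrivial⇒≢1)
open import Data.Nat.Properties
  using (suc-injective; ≤-refl; ≤-trans; ≤-antisym; ≤⇒≤′; m≤n⇒m≤1+n; m≤m+n; +-comm; +-identityʳ
        ; +-monoˡ-≤; 1≤n!; _≤?_; _<?_; ≮⇒≥; <⇒≱; <⇒≢; ≰⇒>; <-cmp; m+[n∸m]≡n; ∸-monoˡ-≤)
open import Data.Nat.Divisibility using (_∣_; ∣-refl; ∣-trans; m∣m*n; ∣1⇒≡1; ∣m+n∣m⇒∣n; ∣⇒≤; m≤n⇒m!∣n!)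
open import Data.Nat.ListAction using (product)
open import Data.Nat.Primality using (Prime; prime?; ¬prime[0]; ¬prime[1]; prime⇒nonZero; prime⇒nonTrivial)
open import Data.Nat.Primality.Factorisation using (factorise)
import Data.Nat.Coprimality as Coprime
open Coprime using (Coprime)
open import Data.Fin using (zero; suc; toℕ; fromℕ<; _≟_)
open import Data.Fin.Properties using (toℕ-fromℕ<; toℕ-injective; toℕ<n; injective⇒≤)
open import Data.List using ([]; _∷_; [_]; _++_; length; filter; upTo)
open import Data.List.Properties using (upTo-∷ʳ; filter-++; filter-accept; filter-reject; length-++)
open import Data.List.Relation.Unary.All using (_∷_)
open import Data.Product using (_,_; proj₁; proj₂; ∃)
open import Data.Sum using (_⊎_; inj₁; inj₂)
open import Function using (_∘_; Injective)
open import Relation.Binary.Definitions using (tri<; tri≈; tri>)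
open import Relation.Nullary using (¬_; yes; no; contradiction)
open import Relation.Nullary.Decidable using (decidable-stable)
open import Relation.Binary.PropositionalEquality as ≡ using (_≡_; _≢_; refl; cong; subst; trans)
open ≡.≡-Reasoning

private
  variable
    c k m n p M : ℕ

∃-prime-divisor : ∀ n → .{{NonTrivial n}} → ∃ λ p → Prime p × p ∣ n
∃-prime-divisor n with factorise n {{nonTrivial⇒nonZero n}}
... | record { factors = [] ; isFactorisation = n≡1 } = contradiction n≡1 nonTrivial⇒≢1
... | record { factors = p ∷ ps ; isFactorisation = n≡p*ps ; factorsPrime = p-prime ∷ _ } =
  p , p-prime , subst (p ∣_) (≡.sym n≡p*ps) (m∣m*n (product ps))

m∣m! : ∀ m → .{{NonZero m}} → m ∣ m !
m∣m! (suc m) = m∣m*n (m !)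

∃-prime> : ∀ n → ∃ λ p → Prime p × n < p
∃-prime> n with ∃-prime-divisor (n ! + 1) {{n>1⇒nonTrivial (+-monoˡ-≤ 1 (1≤n! n))}}
... | p , p-prime , p∣n!+1 with n <? p
...   | yes n<p = p , p-prime , n<p
...   | no n≮p =
        contradiction (∣1⇒≡1 (∣m+n∣m⇒∣n p∣n!+1 p∣n!)) (nonTrivial⇒≢1 {{prime⇒nonTrivial p-prime}})
  where
  p∣n! : p ∣ n !
  p∣n! = ∣-trans (m∣m! p {{prime⇒nonZero p-prime}}) (m≤n⇒m!∣n! (≮⇒≥ n≮p))

primeCount-suc : ∀ m → primeCount (suc m) ≡ primeCount m + length (filter prime? [ suc m ])
primeCount-suc m = begin
  length (filter prime? (upTo (suc (suc m))))
    ≡⟨ cong (length ∘ filter prime?) (upTo-∷ʳ (suc m)) ⟨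
  length (filter prime? (upTo (suc m) ++ [ suc m ]))
    ≡⟨ cong length (filter-++ prime? (upTo (suc m)) [ suc m ]) ⟩
  length (filter prime? (upTo (suc m)) ++ filter prime? [ suc m ])
    ≡⟨ length-++ (filter prime? (upTo (suc m))) ⟩
  primeCount m + length (filter prime? [ suc m ])
    ∎

primeCount-suc-prime : Prime (suc m) → primeCount (suc m) ≡ suc (primeCount m)
primeCount-suc-prime {m} m+1-prime = begin
  primeCount (suc m)                              ≡⟨ primeCount-suc m ⟩
  primeCount m + length (filter prime? [ suc m ]) ≡⟨ cong (λ xs → primeCount m + length xs)
                                                          (filter-accept prime? m+1-prime) ⟩
  primeCount m + 1                                ≡⟨ +-comm (primeCount m) 1 ⟩
  suc (primeCount m)                              ∎

primeCount-suc-¬prime : ¬ Prime (suc m) → primeCount (suc m) ≡ primeCount m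
primeCount-suc-¬prime {m} m+1-composite = begin
  primeCount (suc m)                              ≡⟨ primeCount-suc m ⟩
  primeCount m + length (filter prime? [ suc m ]) ≡⟨ cong (λ xs → primeCount m + length xs)
                                                          (filter-reject prime? m+1-composite) ⟩
  primeCount m + 0                                ≡⟨ +-identityʳ (primeCount m) ⟩
  primeCount m                                    ∎

primeCount-mono-≤ : m ≤ n → primeCount m ≤ primeCount n
primeCount-mono-≤ = mono′ ∘ ≤⇒≤′
  where
  mono′ : m ≤′ n → primeCount m ≤ primeCount n
  mono′ (≤′-reflexive refl) = ≤-refl
  mono′ (≤′-step {n} m≤′n) =
    ≤-trans (mono′ m≤′n) (subst (primeCount n ≤_) (≡.sym (primeCount-suc n)) (m≤m+n _ _))

primeCount-<-prime : Prime p → m < p → primeCount m < primeCount p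
primeCount-<-prime p-prime (s≤s m≤p-1) =
  subst (_ <_) (≡.sym (primeCount-suc-prime p-prime)) (s≤s (primeCount-mono-≤ m≤p-1))

primeCount-≤⇒≤ : Prime p → primeCount p ≤ primeCount n → p ≤ n
primeCount-≤⇒≤ p-prime πp≤πn = ≮⇒≥ (λ n<p → <⇒≱ (primeCount-<-prime p-prime n<p) πp≤πn)

primeCount-unbounded : ∀ k → ∃ λ n → k ≤ primeCount n
primeCount-unbounded zero = 0 , z≤n
primeCount-unbounded (suc k) with primeCount-unbounded k
... | n , k≤πn with ∃-prime> n
...   | p , p-prime , n<p = p , ≤-trans (s≤s k≤πn) (primeCount-<-prime p-prime n<p)

nthPrime-≤ : ∀ n → 1 ≤ k → k ≤ primeCount n → ∃ λ p → p ≤ n × IsNthPrime k p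
nthPrime-≤ zero (s≤s z≤n) ()
nthPrime-≤ {k} (suc n) 1≤k k≤π[n+1] with k ≤? primeCount n
... | yes k≤πn = let p , p≤n , p-nth = nthPrime-≤ n 1≤k k≤πn in p , m≤n⇒m≤1+n p≤n , p-nth
... | no k≰πn with prime? (suc n)
...   | yes n+1-prime =
        suc n , ≤-refl , n+1-prime ,
        ≤-antisym (subst (_≤ k) (≡.sym (primeCount-suc-prime n+1-prime)) (≰⇒> k≰πn)) k≤π[n+1]
...   | no n+1-composite =
        contradiction (subst (k ≤_) (primeCount-suc-¬prime n+1-composite) k≤π[n+1]) k≰πn

nthPrime : 1 ≤ k → ∃ (IsNthPrime k)
nthPrime {k} 1≤k =
  let n , k≤πn = primeCount-unbounded k
      p , _ , p-nth = nthPrime-≤ n 1≤k k≤πn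
  in p , p-nth

OneOrPrime : ℕ → Set
OneOrPrime d = d ≡ 1 ⊎ Prime d

prime≢⇒coprime : Prime m → Prime n → m ≢ n → Coprime m n
prime≢⇒coprime {m} {n} m-prime n-prime m≢n with <-cmp m n
... | tri< m<n _ _ = Coprime.sym (Coprime.prime⇒coprime n-prime {{prime⇒nonZero m-prime}} m<n)
... | tri≈ _ m≡n _ = contradiction m≡n m≢n
... | tri> _ _ n<m = Coprime.prime⇒coprime m-prime {{prime⇒nonZero n-prime}} n<m

oneOrPrime-coprime : OneOrPrime m → OneOrPrime n → m ≢ n → Coprime m n
oneOrPrime-coprime (inj₁ refl) _           _   = Coprime.1-coprimeTo _
oneOrPrime-coprime (inj₂ _)    (inj₁ refl) _   = Coprime.sym (Coprime.1-coprimeTo _)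
oneOrPrime-coprime (inj₂ m-prime) (inj₂ n-prime) m≢n = prime≢⇒coprime m-prime n-prime m≢n

primeCount-<-oneOrPrime : OneOrPrime m → OneOrPrime n → m < n → primeCount m < primeCount n
primeCount-<-oneOrPrime (inj₁ ()) (inj₁ refl) (s≤s z≤n)
primeCount-<-oneOrPrime (inj₂ 0-prime) (inj₁ refl) (s≤s z≤n) = contradiction 0-prime ¬prime[0]
primeCount-<-oneOrPrime _ (inj₂ n-prime) m<n = primeCount-<-prime n-prime m<n

primeCount-injective-oneOrPrime : OneOrPrime m → OneOrPrime n → primeCount m ≡ primeCount n → m ≡ n
primeCount-injective-oneOrPrime {m} {n} m-1p n-1p πm≡πn with <-cmp m n
... | tri< m<n _ _ = contradiction πm≡πn (<⇒≢ (primeCount-<-oneOrPrime m-1p n-1p m<n))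
... | tri≈ _ m≡n _ = m≡n
... | tri> _ _ n<m = contradiction (≡.sym πm≡πn) (<⇒≢ (primeCount-<-oneOrPrime n-1p m-1p n<m))

record OneOrPrimeFactor (m : ℕ) : Set where
  field
    factor       : ℕ
    oneOrPrime   : OneOrPrime factor
    factor∣m     : factor ∣ m
    factor≡1⇒m≡1 : factor ≡ 1 → m ≡ 1

oneOrPrimeFactor : ∀ m → .{{NonZero m}} → OneOrPrimeFactor m
oneOrPrimeFactor 1 =
  record { factor = 1 ; oneOrPrime = inj₁ refl ; factor∣m = ∣-refl ; factor≡1⇒m≡1 = λ _ → refl }
oneOrPrimeFactor m@(suc (suc _)) =
  let p , p-prime , p∣m = ∃-prime-divisor m in
  record { factor = p ; oneOrPrime = inj₂ p-prime ; factor∣m = p∣m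
         ; factor≡1⇒m≡1 = λ p≡1 → contradiction (subst Prime p≡1 p-prime) ¬prime[1] }

pullback : (Fin m → Fin n) → Colouring n c → Colouring m c
pullback f χ = record { col = λ x y → col χ (f x) (f y) ; sym = λ x y → Colouring.sym χ (f x) (f y) }

IsProperColouring : (Fin n → Fin M) → Set
IsProperColouring f = ∀ x y → x ≢ y → Coprime (label x) (label y) → f x ≢ f y

properColouring-injectiveOnClique : {f : Fin n → Fin M} → IsProperColouring f →
  (S : KSubset n k) → IsCoprimeClique S → Injective _≡_ _≡_ (f ∘ vtx S)
properColouring-injectiveOnClique proper S clique {a} {b} fa≡fb = decidable-stable (a ≟ b)
  (λ a≢b → proper _ _ (a≢b ∘ inj S) (clique a b a≢b) fa≡fb)

coprimeArrows-fromClique : {ks : Fin c → ℕ} →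
  Σ (KSubset n M) IsCoprimeClique → ClassicalArrows ks M → CoprimeArrows ks n
coprimeArrows-fromClique (K , K-clique) arrows χ =
  let i , S , S-mono = arrows (pullback (vtx K) χ) in
  i , record { vtx = vtx K ∘ vtx S ; inj = inj S ∘ inj K } ,
  (λ a b a≢b → K-clique _ _ (a≢b ∘ inj S)) , S-mono

classicalArrows-fromProperColouring : {ks : Fin c → ℕ} →
  Σ (Fin n → Fin M) IsProperColouring → CoprimeArrows ks n → ClassicalArrows ks M
classicalArrows-fromProperColouring (f , proper) arrows χ =
  let i , S , S-clique , S-mono = arrows (pullback f χ) in
  i , record { vtx = f ∘ vtx S ; inj = properColouring-injectiveOnClique proper S S-clique } , S-mono

label-injective : {x y : Fin n} → label x ≡ label y → x ≡ y
label-injective = toℕ-injective ∘ suc-injective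

vertexLabelled : .{{NonZero m}} → m ≤ n → Σ (Fin n) λ x → label x ≡ m
vertexLabelled {m = suc m} m+1≤n = fromℕ< m+1≤n , cong suc (toℕ-fromℕ< m+1≤n)

oneOrPrimeVertex : .{{NonZero n}} → (j : Fin (suc (primeCount n))) →
  Σ (Fin n) λ x → OneOrPrime (label x) × primeCount (label x) ≡ toℕ j
oneOrPrimeVertex {n = suc _} zero = zero , inj₁ refl , refl
oneOrPrimeVertex {n = n} (suc j) =
  let p , p≤n , p-prime , πp≡1+j = nthPrime-≤ n (s≤s z≤n) (toℕ<n j)
      x , x≡p = vertexLabelled {{prime⇒nonZero p-prime}} p≤n
  in x , subst OneOrPrime (≡.sym x≡p) (inj₂ p-prime) , trans (cong primeCount x≡p) πp≡1+j

primeClique : ∀ n → .{{NonZero n}} → Σ (KSubset n (suc (primeCount n))) IsCoprimeClique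
primeClique n = record { vtx = vertex ; inj = labelInjective ∘ cong label } ,
  λ i j i≢j → oneOrPrime-coprime (isOneOrPrime i) (isOneOrPrime j) (i≢j ∘ labelInjective)
  where
  vertex : Fin (suc (primeCount n)) → Fin n
  vertex j = proj₁ (oneOrPrimeVertex j)

  isOneOrPrime : ∀ j → OneOrPrime (label (vertex j))
  isOneOrPrime j = proj₁ (proj₂ (oneOrPrimeVertex j))

  labelInjective : ∀ {i j} → label (vertex i) ≡ label (vertex j) → i ≡ j
  labelInjective {i} {j} eq = toℕ-injective (begin
    toℕ i                         ≡⟨ proj₂ (proj₂ (oneOrPrimeVertex i)) ⟨
    primeCount (label (vertex i)) ≡⟨ cong primeCount eq ⟩
    primeCount (label (vertex j)) ≡⟨ proj₂ (proj₂ (oneOrPrimeVertex j)) ⟩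
    toℕ j                         ∎)

-- Vertex m gets colour π(q) where q is 1 or a prime factor of m; π is injective
-- on such q, and coprime m, m' can share q only if q = 1 = m = m'.
primeColouring : ∀ n → Σ (Fin n → Fin (suc (primeCount n))) IsProperColouring
primeColouring n = colour , proper
  where
  open OneOrPrimeFactor

  factorOf : (x : Fin n) → OneOrPrimeFactor (label x)
  factorOf x = oneOrPrimeFactor (label x)

  colour : Fin n → Fin (suc (primeCount n))
  colour x = fromℕ< (s≤s (primeCount-mono-≤ (≤-trans (∣⇒≤ (factor∣m (factorOf x))) (toℕ<n x))))

  proper : IsProperColouring colour
  proper x y x≢y coprime same-colour = x≢y (label-injective (begin
    label x ≡⟨ factor≡1⇒m≡1 (factorOf x) common-factor≡1 ⟩
    1       ≡⟨ factor≡1⇒m≡1 (factorOf y) (trans (≡.sym same-factor) common-factor≡1) ⟨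
    label y ∎))
    where
    same-factor : factor (factorOf x) ≡ factor (factorOf y)
    same-factor = primeCount-injective-oneOrPrime (oneOrPrime (factorOf x)) (oneOrPrime (factorOf y))
      (trans (≡.sym (toℕ-fromℕ< _)) (trans (cong toℕ same-colour) (toℕ-fromℕ< _)))

    common-factor≡1 : factor (factorOf x) ≡ 1
    common-factor≡1 =
      coprime (factor∣m (factorOf x) , subst (_∣ label y) (≡.sym same-factor) (factor∣m (factorOf y)))

leastCoprimeArrows : {ks : Fin c → ℕ} → Prime p →
  IsLeast (ClassicalArrows ks) (suc (primeCount p)) → IsLeast (CoprimeArrows ks) p
leastCoprimeArrows {p = p} p-prime (arrows , least) =
  coprimeArrows-fromClique (primeClique p {{prime⇒nonZero p-prime}}) arrows ,
  λ n arrows-n → primeCount-≤⇒≤ p-prime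
    (s≤s⁻¹ (least _ (classicalArrows-fromProperColouring (primeColouring n) arrows-n)))

classicalArrows-lowerBound : {ks : Fin c → ℕ} → Fin c → ClassicalArrows ks n → ∃ λ i → ks i ≤ n
classicalArrows-lowerBound colour arrows =
  let i , S , _ = arrows (record { col = λ _ _ → colour ; sym = λ _ _ → refl }) in
  i , injective⇒≤ (inj S)

theorem4p4 : (c : ℕ) → 1 ≤ c → (ks : Fin c → ℕ) → (∀ i → 2 ≤ ks i) →
    (R : ℕ) → IsLeast (ClassicalArrows ks) R →
    Σ ℕ λ p → IsNthPrime (R ∸ 1) p × IsLeast (CoprimeArrows ks) p
theorem4p4 c 1≤c ks 2≤ks R leastR =
  let p , p-prime , πp≡R-1 = nthPrime (∸-monoˡ-≤ 1 2≤R)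
      1+πp≡R = trans (cong suc πp≡R-1) (m+[n∸m]≡n (≤-trans (s≤s z≤n) 2≤R))
  in p , (p-prime , πp≡R-1) ,
     leastCoprimeArrows p-prime (subst (IsLeast (ClassicalArrows ks)) (≡.sym 1+πp≡R) leastR)
  where
  2≤R : 2 ≤ R
  2≤R = let i , ks≤R = classicalArrows-lowerBound (fromℕ< 1≤c) (proj₁ leastR) in ≤-trans (2≤ks i) ks≤R
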